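{- Let $\Psi$ be an SP-expression whose set of variables is $X=\{x_1,\ldots,x_n\}$ (each variable occurring exactly once), let $\alpha$ be the SP-order on $X$ determined by $\Psi$, and let $\alpha^{*}$ be the SP-order on $X$ determined by the dual SP-expression $\Psi^{*}$. Define the quantitative entropy $H_q=\log_2|R(\alpha)|$, the positional entropy $H_p=\log_2|R(\alpha^{*})|$, and the maximum entropy $H_{max}=\log_2(n!)$. Then $$H_p+H_q=H_{max},$$ i.e. $|R(\alpha)|\cdot|R(\alpha^{*})|=n!$.
   Context: All partial orders are finite. For partial orders $\alpha_1=(A_1,\sqsubseteq_1)$ and $\alpha_2=(A_2,\sqsubseteq_2)$ with $A_1\cap A_2=\emptyset$, the series composition is $\alpha_1\otimes\alpha_2=(A_1\cup A_2,\ \sqsubseteq_1\cup\sqsubseteq_2\cup(A_1\times A_2))$ (every element of $\alpha_1$ lies below every element of $\alpha_2$), and the parallel composition is $\alpha_1\parallel\alpha_2=(A_1\cup A_2,\ \sqsubseteq_1\cup\sqsubseteq_2)$ (elements of $\alpha_1$ and $\alpha_2$ mutually incomparable). SP-expressions are defined inductively: a variable $x_i$ is an SP-expression; if $\Psi_1,\Psi_2$ are SP-expressions with disjoint sets of variables, then $(\Psi_1\otimes\Psi_2)$ and $(\Psi_1\parallel\Psi_2)$ are SP-expressions. The SP-order determined by an SP-expression $\Psi$ on its variable set $X$ is obtained by interpreting each variable $x_i$ as the one-element order on $\{x_i\}$, each symbol $\otimes$ as series composition and each symbol $\parallel$ as parallel composition, evaluated according to the bracketing. The dual SP-expression $\Psi^{*}$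 is obtained from $\Psi$ by interchanging every $\otimes$ with $\parallel$ and every $\parallel$ with $\otimes$. For a finite partial order $\alpha=(X,\sqsubseteq)$ with $|X|=n$, its state space $R(\alpha)$ is the set of root states of $\alpha$: the bijections $l:X\to\{1,\ldots,n\}$ that are increasing, i.e. $x\sqsubseteq y$ with $x\neq y$ implies $l(x)<l(y)$ (equivalently, the topological sorts/linear extensions of $\alpha$ up to relabeling isomorphism). Thus $|R(\alpha)|$ is the number of linear extensions of $\alpha$. -}

module Defs where

open import Data.Nat using (ℕ; zero; suc; _+_)
open import Data.Bool using (Bool; true; false; T; _∨_)
open import Data.Fin using (Fin; splitAt; _<_)
open import Data.Fin.Properties using (_≟_; _<?_; all?; any?)
open import Data.Sum using (_⊎_; inj₁; inj₂)
open import Data.Product using (_×_; ∃)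
open import Data.List using (List; []; _∷_; [_]; map; concatMap; filter; length; allFin)
open import Data.Vec using (Vec; lookup) renaming ([] to []ᵛ; _∷_ to _∷ᵛ_)
open import Relation.Binary.PropositionalEquality using (_≡_)
open import Relation.Nullary using (Dec; ¬_)
open import Relation.Nullary.Decidable using (_→-dec_; _×-dec_; _⊎-dec_; ¬?)
open import Data.Bool.Properties using (T?)

-- Each variable occurs exactly once;
-- the variables are identified with their positions 0..n-1 (Fin n) in
-- left-to-right order of the expression (the disjointness condition on
-- variable sets is thus built in).
data SP : ℕ → Set where
  var : SP 1
  _⊗_ : ∀ {m k} → SP m → SP k → SP (m + k)
  _∥_ : ∀ {m k} → SP m → SP k → SP (m + k)

infixr 6 _⊗_ _∥_

dual : ∀ {n} → SP n → SP n
dual var = var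
dual (a ⊗ b) = dual a ∥ dual b
dual (a ∥ b) = dual a ⊗ dual b

below : ∀ {n} → SP n → Fin n → Fin n → Bool
below var x y = false
below (_⊗_ {m} a b) x y with splitAt m x | splitAt m y
... | inj₁ i | inj₁ j = below a i j
... | inj₂ i | inj₂ j = below b i j
... | inj₁ i | inj₂ j = true
... | inj₂ i | inj₁ j = false
below (_∥_ {m} a b) x y with splitAt m x | splitAt m y
... | inj₁ i | inj₁ j = below a i j
... | inj₂ i | inj₂ j = below b i j
... | inj₁ i | inj₂ j = false
... | inj₂ i | inj₁ j = false

_⊑⟨_⟩_ : ∀ {n} → Fin n → SP n → Fin n → Set
x ⊑⟨ Ψ ⟩ y = (x ≡ y) ⊎ T (below Ψ x y)

_⊑?⟨_⟩_ : ∀ {n} (x : Fin n) (Ψ : SP n) (y : Fin n) → Dec (x ⊑⟨ Ψ ⟩ y)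
x ⊑?⟨ Ψ ⟩ y = (x ≟ y) ⊎-dec T? (below Ψ x y)

-- a root state of the SP-order of Ψ: a bijection l : X → {1..n}
-- (labels represented as Fin n = {0..n-1}) that is increasing
Bijective : ∀ {n} → (Fin n → Fin n) → Set
Bijective {n} l = (∀ x y → l x ≡ l y → x ≡ y) × (∀ z → ∃ λ x → l x ≡ z)

Increasing : ∀ {n} → SP n → (Fin n → Fin n) → Set
Increasing Ψ l = ∀ x y → x ⊑⟨ Ψ ⟩ y × ¬ (x ≡ y) → l x < l y

IsRootState : ∀ {n} → SP n → (Fin n → Fin n) → Set
IsRootState Ψ l = Bijective l × Increasing Ψ l

isRootState? : ∀ {n} (Ψ : SP n) (l : Fin n → Fin n) → Dec (IsRootState Ψ l)
isRootState? Ψ l =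
  (all? (λ x → all? (λ y → (l x ≟ l y) →-dec (x ≟ y)))
    ×-dec all? (λ z → any? (λ x → l x ≟ z)))
  ×-dec all? (λ x → all? (λ y → ((x ⊑?⟨ Ψ ⟩ y) ×-dec ¬? (x ≟ y)) →-dec (l x <? l y)))

allVecs : ∀ n m → List (Vec (Fin m) n)
allVecs zero m = [ []ᵛ ]
allVecs (suc n) m = concatMap (λ v → map (_∷ᵛ v) (allFin m)) (allVecs n m)

numRootStates : ∀ {n} → SP n → ℕ
numRootStates {n} Ψ = length (filter (λ v → isRootState? Ψ (lookup v)) (allVecs n n))

-- Count the root states (linear extensions) of any finite relation R by the element labelled
-- first: it must be minimal, and the remaining labels form a root state of R without it, so
-- N(R) = Σ N(R − x) over the minimal x.  In a series composition all minimal elements lie on the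
-- left, which gives N(α ⊗ β) = N(α) N(β); in a parallel composition they come from both sides,
-- and the recursion is Pascal's rule, giving N(α ∥ β) = C(m + k, m) N(α) N(β).  Dualising swaps
-- ⊗ and ∥ at every node, so by induction N(Ψ) N(Ψ*) = C(m + k, m) m! k! = (m + k)!.

module Submission where

open import Defs
open import Data.Nat using (ℕ; zero; suc; pred; _+_; _*_; _∸_; _/_; _!; z≤n; s≤s; s<s⁻¹) renaming (_≤_ to _≤ℕ_)
open import Data.Nat.Properties
  using (≤-antisym; +-suc; +-assoc; +-identityʳ; *-identityˡ; *-comm; n≮0; m≤m+n; m+n∸m≡n; _!*_!≢0; +-*-semiring; *-commutativeSemigroup)
open import Data.Nat.Combinatorics using (_C_; nCk≡n!/k![n-k]!; k![n∸k]!∣n!; nCn≡1; nCk+nC[k+1]≡[n+1]C[k+1])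
open import Data.Nat.DivMod using (m/n*n≡m)
open import Data.Nat.Solver using (module +-*-Solver)
open import Algebra.Properties.CommutativeSemigroup *-commutativeSemigroup using (x∙yz≈y∙xz)
open import Data.Bool using (Bool; true; false; T)
open import Data.Bool.Properties using (T?)
open import Data.Fin using (Fin; splitAt; _<_; punchIn; punchOut; _↑ˡ_; _↑ʳ_; cast) renaming (zero to fz; suc to fs)
open import Data.Fin.Properties
  using (_≟_; _<?_; all?; any?; splitAt-↑ˡ; splitAt-↑ʳ; splitAt⁻¹-↑ˡ; splitAt⁻¹-↑ʳ; ↑ˡ-injective; ↑ʳ-injective;
         punchIn-punchOut; punchInᵢ≢i; punchIn-injective; cast-is-id; suc-injective; 0≢1+n)
open import Data.Sum using (_⊎_; inj₁; inj₂; map₁; map₂)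
open import Data.Sum.Properties using (map-map; map₁₂-map₂₁)
open import Data.Product using (_×_; ∃; _,_; proj₁; proj₂)
open import Data.List using (List; []; _∷_; map; concatMap; filter; length; allFin; _++_; cartesianProductWith; cartesianProduct; tabulate)
open import Data.List.Properties using (length-++; filter-++; filter-≐; filter-none)
open import Data.List.Membership.Propositional using (_∈_)
open import Data.List.Membership.Propositional.Properties
  using (∈-∃++; ∈-filter⁺; ∈-filter⁻; ∈-allFin; ∈-cartesianProductWith⁺; ∈-cartesianProduct⁺)
open import Data.List.Relation.Unary.Any using (here; there)
import Data.List.Relation.Unary.All as All
open import Data.List.Relation.Unary.AllPairs using ([]; _∷_)
open import Data.List.Relation.Unary.Unique.Propositional using (Unique)
open import Data.List.Relation.Unary.Unique.Propositional.Properties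
  using (Unique[x∷xs]⇒x∉xs; filter⁺; allFin⁺; cartesianProductWith⁺; cartesianProduct⁺)
open import Data.Vec using (Vec; lookup; insertAt) renaming ([] to []ᵛ; _∷_ to _∷ᵛ_; tabulate to tabulateᵛ; map to mapᵛ)
open import Data.Vec.Properties using (insertAt-lookup; insertAt-punchIn; lookup-map; lookup∘tabulate; tabulate∘lookup; tabulate-cong)
open import Algebra.Properties.Semiring.Sum +-*-semiring using (sum; sum-cong-≗; *-distribʳ-sum; sum-replicate-zero)
open import Relation.Binary.PropositionalEquality using (_≡_; _≢_; refl; sym; trans; cong; cong₂; subst; subst₂; module ≡-Reasoning)
open import Relation.Nullary using (Dec; yes; no; ¬_)
open import Relation.Nullary.Decidable using (_→-dec_; _×-dec_; _⊎-dec_; ¬?)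
open import Relation.Unary using (Decidable)
open import Data.Empty using (⊥-elim)
open import Data.Unit using (tt)

open ≡-Reasoning
open +-*-Solver using (solve; _:+_; _:*_; _:=_)

-- Counting through a bijection

∈-++-∷⁻ : ∀ {A : Set} {x y : A} (us : List A) {vs : List A} → x ∈ us ++ y ∷ vs → x ≢ y → x ∈ us ++ vs
∈-++-∷⁻ []       (here x≡y) x≢y = ⊥-elim (x≢y x≡y)
∈-++-∷⁻ []       (there x∈) x≢y = x∈
∈-++-∷⁻ (u ∷ us) (here x≡u) x≢y = here x≡u
∈-++-∷⁻ (u ∷ us) (there x∈) x≢y = there (∈-++-∷⁻ us x∈ x≢y)

length-++-∷ : ∀ {A : Set} (us : List A) (y : A) (vs : List A) → length (us ++ y ∷ vs) ≡ suc (length (us ++ vs))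
length-++-∷ []       y vs = refl
length-++-∷ (u ∷ us) y vs = cong suc (length-++-∷ us y vs)

injection⇒length-≤ : ∀ {A B : Set} (f : A → B) (xs : List A) (ys : List B) → Unique xs →
  (∀ x → x ∈ xs → f x ∈ ys) → (∀ x x′ → x ∈ xs → x′ ∈ xs → f x ≡ f x′ → x ≡ x′) →
  length xs ≤ℕ length ys
injection⇒length-≤ f []       ys _             _    _   = z≤n
injection⇒length-≤ f (x ∷ xs) ys u@(_ ∷ uxs) into inj with ∈-∃++ (into x (here refl))
... | us , vs , refl = subst (suc (length xs) ≤ℕ_) (sym (length-++-∷ us (f x) vs))
  (s≤s (injection⇒length-≤ f xs (us ++ vs) uxs into′ (λ z z′ z∈ z′∈ → inj z z′ (there z∈) (there z′∈))))
  where
  into′ : ∀ z → z ∈ xs → f z ∈ us ++ vs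
  into′ z z∈ = ∈-++-∷⁻ us (into z (there z∈))
    (λ fz≡fx → Unique[x∷xs]⇒x∉xs u (subst (_∈ xs) (inj z x (there z∈) (here refl) fz≡fx) z∈))

length-filter-≤ : ∀ {A B : Set} {P : A → Set} {Q : B → Set} (P? : Decidable P) (Q? : Decidable Q)
  (xs : List A) (ys : List B) → Unique xs → (∀ y → y ∈ ys) →
  (f : A → B) → (∀ x → P x → Q (f x)) → (∀ x x′ → P x → P x′ → f x ≡ f x′ → x ≡ x′) →
  length (filter P? xs) ≤ℕ length (filter Q? ys)
length-filter-≤ P? Q? xs ys uxs ∈ys f PQ inj = injection⇒length-≤ f (filter P? xs) (filter Q? ys) (filter⁺ P? uxs)
  (λ x x∈ → ∈-filter⁺ Q? (∈ys (f x)) (PQ x (proj₂ (∈-filter⁻ P? {xs = xs} x∈))))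
  (λ x x′ x∈ x′∈ → inj x x′ (proj₂ (∈-filter⁻ P? {xs = xs} x∈)) (proj₂ (∈-filter⁻ P? {xs = xs} x′∈)))

length-filter-bijection : ∀ {A B : Set} {P : A → Set} {Q : B → Set} (P? : Decidable P) (Q? : Decidable Q)
  (xs : List A) (ys : List B) → Unique xs → (∀ x → x ∈ xs) → Unique ys → (∀ y → y ∈ ys) →
  (f : A → B) (g : B → A) → (∀ x → P x → Q (f x)) → (∀ y → Q y → P (g y)) →
  (∀ x → P x → g (f x) ≡ x) → (∀ y → Q y → f (g y) ≡ y) →
  length (filter P? xs) ≡ length (filter Q? ys)
length-filter-bijection P? Q? xs ys uxs ∈xs uys ∈ys f g PQ QP gf fg = ≤-antisym
  (length-filter-≤ P? Q? xs ys uxs ∈ys f PQ (λ x x′ px px′ e → trans (sym (gf x px)) (trans (cong g e) (gf x′ px′))))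
  (length-filter-≤ Q? P? ys xs uys ∈xs g QP (λ y y′ qy qy′ e → trans (sym (fg y qy)) (trans (cong f e) (fg y′ qy′))))

length-filter-map : ∀ {A B : Set} {Q : B → Set} (Q? : Decidable Q) (h : A → B) (xs : List A) →
  length (filter Q? (map h xs)) ≡ length (filter (λ x → Q? (h x)) xs)
length-filter-map Q? h []       = refl
length-filter-map Q? h (x ∷ xs) with Q? (h x)
... | yes _ = cong suc (length-filter-map Q? h xs)
... | no  _ = length-filter-map Q? h xs

length-filter-cartesianProduct : ∀ {A B : Set} {Q : A × B → Set} (Q? : Decidable Q) N (f : Fin N → A) (ys : List B) →
  length (filter Q? (cartesianProduct (tabulate f) ys)) ≡ sum (λ i → length (filter (λ y → Q? (f i , y)) ys))
length-filter-cartesianProduct Q? zero    f ys = refl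
length-filter-cartesianProduct {A} {B} Q? (suc N) f ys = begin
    length (filter Q? (map (f fz ,_) ys ++ rest))
  ≡⟨ cong length (filter-++ Q? (map (f fz ,_) ys) rest) ⟩
    length (filter Q? (map (f fz ,_) ys) ++ filter Q? rest)
  ≡⟨ length-++ (filter Q? (map (f fz ,_) ys)) ⟩
    length (filter Q? (map (f fz ,_) ys)) + length (filter Q? rest)
  ≡⟨ cong₂ _+_ (length-filter-map Q? (f fz ,_) ys) (length-filter-cartesianProduct Q? N (λ i → f (fs i)) ys) ⟩
    sum (λ i → length (filter (λ y → Q? (f i , y)) ys))
  ∎
  where
  rest : List (A × B)
  rest = cartesianProduct (tabulate (λ i → f (fs i))) ys

allVecs-cartesianProduct : ∀ n m → allVecs (suc n) m ≡ cartesianProductWith (λ v i → i ∷ᵛ v) (allVecs n m) (allFin m)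
allVecs-cartesianProduct n m = go (allVecs n m)
  where
  go : ∀ vs → concatMap (λ v → map (_∷ᵛ v) (allFin m)) vs ≡ cartesianProductWith (λ v i → i ∷ᵛ v) vs (allFin m)
  go []       = refl
  go (v ∷ vs) = cong (map (_∷ᵛ v) (allFin m) ++_) (go vs)

Unique-allVecs : ∀ n m → Unique (allVecs n m)
Unique-allVecs zero    m = All.[] ∷ []
Unique-allVecs (suc n) m rewrite allVecs-cartesianProduct n m =
  cartesianProductWith⁺ (λ v i → i ∷ᵛ v) (λ { refl → refl , refl }) (Unique-allVecs n m) (allFin⁺ m)

∈-allVecs : ∀ n m (v : Vec (Fin m) n) → v ∈ allVecs n m
∈-allVecs zero    m []ᵛ       = here refl
∈-allVecs (suc n) m (i ∷ᵛ v) rewrite allVecs-cartesianProduct n m =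
  ∈-cartesianProductWith⁺ (λ v i → i ∷ᵛ v) (∈-allVecs n m v) (∈-allFin i)

-- Root states of an arbitrary Boolean relation

BoolRel : ℕ → Set
BoolRel n = Fin n → Fin n → Bool

IsRootStateOf : ∀ {n} → BoolRel n → (Fin n → Fin n) → Set
IsRootStateOf R l = Bijective l × (∀ x y → ((x ≡ y) ⊎ T (R x y)) × ¬ (x ≡ y) → l x < l y)

-- Mirrors isRootState?, so that numRootStates Ψ is rootCount n (below Ψ) by definition.
isRootStateOf? : ∀ {n} (R : BoolRel n) (l : Fin n → Fin n) → Dec (IsRootStateOf R l)
isRootStateOf? R l =
  (all? (λ x → all? (λ y → (l x ≟ l y) →-dec (x ≟ y)))
    ×-dec all? (λ z → any? (λ x → l x ≟ z)))
  ×-dec all? (λ x → all? (λ y → (((x ≟ y) ⊎-dec T? (R x y)) ×-dec ¬? (x ≟ y)) →-dec (l x <? l y)))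

rootCount : ∀ n → BoolRel n → ℕ
rootCount n R = length (filter (λ v → isRootStateOf? R (lookup v)) (allVecs n n))

rootCount-cong : ∀ {n} {R R′ : BoolRel n} → (∀ x y → R x y ≡ R′ x y) → rootCount n R ≡ rootCount n R′
rootCount-cong {n} {R} {R′} R≡R′ =
  cong length (filter-≐ (λ v → isRootStateOf? R (lookup v)) (λ v → isRootStateOf? R′ (lookup v))
    (transport R≡R′ , transport (λ x y → sym (R≡R′ x y))) (allVecs n n))
  where
  transport : ∀ {S S′ : BoolRel n} → (∀ x y → S x y ≡ S′ x y) → ∀ {l} → IsRootStateOf S l → IsRootStateOf S′ l
  transport S≡S′ (bij , inc) = bij , λ where
    x y (inj₁ x≡y , x≢y) → inc x y (inj₁ x≡y , x≢y)
    x y (inj₂ xSy , x≢y) → inc x y (inj₂ (subst T (sym (S≡S′ x y)) xSy) , x≢y)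

rootCount-cast : ∀ {n n′} (e : n ≡ n′) (R : BoolRel n′) → rootCount n′ R ≡ rootCount n (λ x y → R (cast e x) (cast e y))
rootCount-cast refl R = rootCount-cong (λ x y → cong₂ R (sym (cast-is-id refl x)) (sym (cast-is-id refl y)))

-- Peeling off the element labelled first

Minimal : ∀ {n} → BoolRel n → Fin n → Set
Minimal R x = ∀ y → T (R y x) → y ≡ x

minimal? : ∀ {n} (R : BoolRel n) x → Dec (Minimal R x)
minimal? R x = all? (λ y → T? (R y x) →-dec (y ≟ x))

restrict : ∀ {n} → BoolRel (suc n) → Fin (suc n) → BoolRel n
restrict R x a b = R (punchIn x a) (punchIn x b)

rootsFirstAt : ∀ {n} → BoolRel (suc n) → Fin (suc n) → ℕ
rootsFirstAt {n} R x = length (filter (λ w → minimal? R x ×-dec isRootStateOf? (restrict R x) (lookup w)) (allVecs n n))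

rootsFirstAt-minimal : ∀ {n} (R : BoolRel (suc n)) x → Minimal R x → rootsFirstAt R x ≡ rootCount n (restrict R x)
rootsFirstAt-minimal {n} R x min = cong length (filter-≐ _ _ (proj₂ , (min ,_)) (allVecs n n))

rootsFirstAt-¬minimal : ∀ {n} (R : BoolRel (suc n)) x → ¬ Minimal R x → rootsFirstAt R x ≡ 0
rootsFirstAt-¬minimal {n} R x ¬min = cong length (filter-none _ (All.universal (λ _ p → ¬min (proj₁ p)) (allVecs n n)))

predOr : ∀ {n} → Fin n → Fin (suc n) → Fin n
predOr d fz     = d
predOr d (fs j) = j

punchIn-view : ∀ {n} (x y : Fin (suc n)) → y ≡ x ⊎ ∃ λ j → punchIn x j ≡ y
punchIn-view x y with y ≟ x
... | yes y≡x = inj₁ y≡x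
... | no  y≢x = inj₂ (punchOut (λ x≡y → y≢x (sym x≡y)) , punchIn-punchOut _)

lookup-ext : ∀ {A : Set} {k} (u v : Vec A k) → (∀ i → lookup u i ≡ lookup v i) → u ≡ v
lookup-ext u v u≗v = trans (sym (tabulate∘lookup u)) (trans (tabulate-cong u≗v) (tabulate∘lookup v))

module Peel {n : ℕ} (R : BoolRel (suc n)) where

  private
    Labelling : Set
    Labelling = Vec (Fin (suc n)) (suc n)

    Labelling′ : Set
    Labelling′ = Vec (Fin n) n

    Injective : Labelling → Set
    Injective v = ∀ a b → lookup v a ≡ lookup v b → a ≡ b

    IsRoot : Labelling → Set
    IsRoot v = IsRootStateOf R (lookup v)

    IsSplitRoot : Fin (suc n) × Labelling′ → Set
    IsSplitRoot (x , w) = Minimal R x × IsRootStateOf (restrict R x) (lookup w)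

    isSplitRoot? : Decidable IsSplitRoot
    isSplitRoot? (x , w) = minimal? R x ×-dec isRootStateOf? (restrict R x) (lookup w)

    first : Labelling → Fin (suc n)
    first v with any? (λ x → lookup v x ≟ fz)
    ... | yes (x , _) = x
    ... | no  _       = fz

    first-unique : ∀ v x → lookup v x ≡ fz → Injective v → first v ≡ x
    first-unique v x vx≡0 inj with any? (λ x → lookup v x ≟ fz)
    ... | yes (y , vy≡0) = inj y x (trans vy≡0 (sym vx≡0))
    ... | no  none       = ⊥-elim (none (x , vx≡0))

    -- The default of predOr is never used: off x, a labelling with l x = 0 is nonzero.
    lowered : Fin (suc n) → Labelling → Labelling′
    lowered x v = tabulateᵛ (λ i → predOr i (lookup v (punchIn x i)))

    split : Labelling → Fin (suc n) × Labelling′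
    split v = first v , lowered (first v) v

    unsplit : Fin (suc n) × Labelling′ → Labelling
    unsplit (x , w) = insertAt (mapᵛ fs w) x fz

    unsplit-at : ∀ x w → lookup (unsplit (x , w)) x ≡ fz
    unsplit-at x w = insertAt-lookup (mapᵛ fs w) x fz

    unsplit-punchIn : ∀ x w j → lookup (unsplit (x , w)) (punchIn x j) ≡ fs (lookup w j)
    unsplit-punchIn x w j = trans (insertAt-punchIn (mapᵛ fs w) x fz j) (lookup-map j fs w)

    lowered-lookup : ∀ x v i t → lookup v (punchIn x i) ≡ fs t → lookup (lowered x v) i ≡ t
    lowered-lookup x v i t e = trans (lookup∘tabulate _ i) (cong (predOr i) e)

    off-first-nonzero : ∀ v x → lookup v x ≡ fz → Injective v → ∀ i → ∃ λ t → lookup v (punchIn x i) ≡ fs t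
    off-first-nonzero v x vx≡0 inj i with lookup v (punchIn x i) in eq
    ... | fz   = ⊥-elim (punchInᵢ≢i x i (inj _ _ (trans eq (sym vx≡0))))
    ... | fs t = t , refl

    first-minimal : ∀ v x → IsRoot v → lookup v x ≡ fz → Minimal R x
    first-minimal v x (_ , inc) vx≡0 y yRx with y ≟ x
    ... | yes y≡x = y≡x
    ... | no  y≢x = ⊥-elim (n≮0 (subst (lookup v y <_) vx≡0 (inc y x (inj₂ yRx , y≢x))))

    lowered-root : ∀ v x → IsRoot v → lookup v x ≡ fz → IsRootStateOf (restrict R x) (lookup (lowered x v))
    lowered-root v x ((inj , surj) , inc) vx≡0 = (inj′ , surj′) , inc′
      where
      nonzero : ∀ i → ∃ λ t → lookup v (punchIn x i) ≡ fs t
      nonzero = off-first-nonzero v x vx≡0 inj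
      inj′ : ∀ i j → lookup (lowered x v) i ≡ lookup (lowered x v) j → i ≡ j
      inj′ i j eq with nonzero i | nonzero j
      ... | a , ea | b , eb = punchIn-injective x i j (inj _ _ (begin
        lookup v (punchIn x i) ≡⟨ ea ⟩
        fs a                   ≡⟨ cong fs (trans (sym (lowered-lookup x v i a ea)) (trans eq (lowered-lookup x v j b eb))) ⟩
        fs b                   ≡⟨ sym eb ⟩
        lookup v (punchIn x j) ∎))
      surj′ : ∀ z → ∃ λ i → lookup (lowered x v) i ≡ z
      surj′ z with surj (fs z)
      ... | y , vy≡z+1 with punchIn-view x y
      ...   | inj₁ refl       = ⊥-elim (0≢1+n (trans (sym vx≡0) vy≡z+1))
      ...   | inj₂ (j , refl) = j , lowered-lookup x v j z vy≡z+1
      inc′ : ∀ i j → ((i ≡ j) ⊎ T (restrict R x i j)) × ¬ (i ≡ j) → lookup (lowered x v) i < lookup (lowered x v) j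
      inc′ i j (inj₁ i≡j , i≢j) = ⊥-elim (i≢j i≡j)
      inc′ i j (inj₂ iRj , i≢j) with nonzero i | nonzero j
      ... | a , ea | b , eb =
        subst₂ _<_ (sym (lowered-lookup x v i a ea)) (sym (lowered-lookup x v j b eb))
          (s<s⁻¹ (subst₂ _<_ ea eb (inc _ _ (inj₂ iRj , λ e → i≢j (punchIn-injective x i j e)))))

    unsplit-root : ∀ p → IsSplitRoot p → IsRoot (unsplit p)
    unsplit-root (x , w) (min , ((inj , surj) , inc)) = (inj′ , surj′) , inc′
      where
      l : Fin (suc n) → Fin (suc n)
      l = lookup (unsplit (x , w))
      inj′ : ∀ y y′ → l y ≡ l y′ → y ≡ y′
      inj′ y y′ eq with punchIn-view x y | punchIn-view x y′
      ... | inj₁ refl       | inj₁ refl        = refl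
      ... | inj₁ refl       | inj₂ (j′ , refl) = ⊥-elim (0≢1+n (trans (sym (unsplit-at x w)) (trans eq (unsplit-punchIn x w j′))))
      ... | inj₂ (j , refl) | inj₁ refl        = ⊥-elim (0≢1+n (trans (sym (unsplit-at x w)) (trans (sym eq) (unsplit-punchIn x w j))))
      ... | inj₂ (j , refl) | inj₂ (j′ , refl) =
        cong (punchIn x) (inj j j′ (suc-injective (trans (sym (unsplit-punchIn x w j)) (trans eq (unsplit-punchIn x w j′)))))
      surj′ : ∀ z → ∃ λ y → l y ≡ z
      surj′ fz     = x , unsplit-at x w
      surj′ (fs z) with surj z
      ... | j , wj≡z = punchIn x j , trans (unsplit-punchIn x w j) (cong fs wj≡z)
      inc′ : ∀ y y′ → ((y ≡ y′) ⊎ T (R y y′)) × ¬ (y ≡ y′) → l y < l y′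
      inc′ y y′ (inj₁ y≡y′ , y≢y′) = ⊥-elim (y≢y′ y≡y′)
      inc′ y y′ (inj₂ yRy′ , y≢y′) with punchIn-view x y′
      ... | inj₁ refl = ⊥-elim (y≢y′ (min y yRy′))
      ... | inj₂ (j′ , refl) with punchIn-view x y
      ...   | inj₁ refl       = subst₂ _<_ (sym (unsplit-at x w)) (sym (unsplit-punchIn x w j′)) (s≤s z≤n)
      ...   | inj₂ (j , refl) = subst₂ _<_ (sym (unsplit-punchIn x w j)) (sym (unsplit-punchIn x w j′))
                                  (s≤s (inc j j′ (inj₂ yRy′ , λ j≡j′ → y≢y′ (cong (punchIn x) j≡j′))))

    unsplit-lowered : ∀ v x → lookup v x ≡ fz → Injective v → unsplit (x , lowered x v) ≡ v
    unsplit-lowered v x vx≡0 inj = lookup-ext _ _ pointwise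
      where
      pointwise : ∀ y → lookup (unsplit (x , lowered x v)) y ≡ lookup v y
      pointwise y with punchIn-view x y
      ... | inj₁ refl = trans (unsplit-at x _) (sym vx≡0)
      ... | inj₂ (j , refl) with off-first-nonzero v x vx≡0 inj j
      ...   | t , vj≡t+1 = trans (unsplit-punchIn x _ j) (trans (cong fs (lowered-lookup x v j t vj≡t+1)) (sym vj≡t+1))

    split-root : ∀ v → IsRoot v → IsSplitRoot (split v)
    split-root v root@((inj , surj) , _) with surj fz
    ... | x , vx≡0 rewrite first-unique v x vx≡0 inj = first-minimal v x root vx≡0 , lowered-root v x root vx≡0

    unsplit∘split : ∀ v → IsRoot v → unsplit (split v) ≡ v
    unsplit∘split v ((inj , surj) , _) with surj fz
    ... | x , vx≡0 rewrite first-unique v x vx≡0 inj = unsplit-lowered v x vx≡0 inj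

    split∘unsplit : ∀ p → IsSplitRoot p → split (unsplit p) ≡ p
    split∘unsplit (x , w) q with unsplit-root (x , w) q
    ... | (inj , _) , _ rewrite first-unique (unsplit (x , w)) x (unsplit-at x w) inj =
      cong (x ,_) (lookup-ext _ _ (λ i → lowered-lookup x (unsplit (x , w)) i (lookup w i) (unsplit-punchIn x w i)))

  rootCount-peel : rootCount (suc n) R ≡ sum (rootsFirstAt R)
  rootCount-peel = trans
    (length-filter-bijection (λ v → isRootStateOf? R (lookup v)) isSplitRoot?
      (allVecs (suc n) (suc n)) (cartesianProduct (allFin (suc n)) (allVecs n n))
      (Unique-allVecs (suc n) (suc n)) (∈-allVecs (suc n) (suc n))
      (cartesianProduct⁺ (allFin⁺ (suc n)) (Unique-allVecs n n))
      (λ { (x , w) → ∈-cartesianProduct⁺ (∈-allFin x) (∈-allVecs n n w) })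
      split unsplit split-root unsplit-root unsplit∘split split∘unsplit)
    (length-filter-cartesianProduct isSplitRoot? (suc n) (λ i → i) (allVecs n n))

open Peel using (rootCount-peel)

-- Series and parallel composition of Boolean relations

-- The Boolean c is the relation between every left and every right element:
-- true for series composition, false for parallel composition.
sumRel : ∀ {m k} → Bool → BoolRel m → BoolRel k → Fin m ⊎ Fin k → Fin m ⊎ Fin k → Bool
sumRel c A B (inj₁ i) (inj₁ j) = A i j
sumRel c A B (inj₂ i) (inj₂ j) = B i j
sumRel c A B (inj₁ i) (inj₂ j) = c
sumRel c A B (inj₂ i) (inj₁ j) = false

compose : ∀ {m k} → Bool → BoolRel m → BoolRel k → BoolRel (m + k)
compose {m} c A B x y = sumRel c A B (splitAt m x) (splitAt m y)

below-⊗ : ∀ {m k} (a : SP m) (b : SP k) x y → below (a ⊗ b) x y ≡ compose true (below a) (below b) x y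
below-⊗ {m} a b x y with splitAt m x | splitAt m y
... | inj₁ i | inj₁ j = refl
... | inj₁ i | inj₂ j = refl
... | inj₂ i | inj₁ j = refl
... | inj₂ i | inj₂ j = refl

below-∥ : ∀ {m k} (a : SP m) (b : SP k) x y → below (a ∥ b) x y ≡ compose false (below a) (below b) x y
below-∥ {m} a b x y with splitAt m x | splitAt m y
... | inj₁ i | inj₁ j = refl
... | inj₁ i | inj₂ j = refl
... | inj₂ i | inj₁ j = refl
... | inj₂ i | inj₂ j = refl

splitAt-view : ∀ m {k} (y : Fin (m + k)) → (∃ λ i → i ↑ˡ k ≡ y) ⊎ (∃ λ j → m ↑ʳ j ≡ y)
splitAt-view m y with splitAt m y in eq
... | inj₁ i = inj₁ (i , splitAt⁻¹-↑ˡ eq)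
... | inj₂ j = inj₂ (j , splitAt⁻¹-↑ʳ eq)

module _ (c : Bool) {m k : ℕ} (A : BoolRel m) (B : BoolRel k) where

  compose-↑ˡ-↑ˡ : ∀ i j → compose c A B (i ↑ˡ k) (j ↑ˡ k) ≡ A i j
  compose-↑ˡ-↑ˡ i j rewrite splitAt-↑ˡ m i k | splitAt-↑ˡ m j k = refl

  compose-↑ʳ-↑ʳ : ∀ i j → compose c A B (m ↑ʳ i) (m ↑ʳ j) ≡ B i j
  compose-↑ʳ-↑ʳ i j rewrite splitAt-↑ʳ m k i | splitAt-↑ʳ m k j = refl

  compose-↑ˡ-↑ʳ : ∀ i j → compose c A B (i ↑ˡ k) (m ↑ʳ j) ≡ c
  compose-↑ˡ-↑ʳ i j rewrite splitAt-↑ˡ m i k | splitAt-↑ʳ m k j = refl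

  compose-↑ʳ-↑ˡ : ∀ i j → compose c A B (m ↑ʳ i) (j ↑ˡ k) ≡ false
  compose-↑ʳ-↑ˡ i j rewrite splitAt-↑ʳ m k i | splitAt-↑ˡ m j k = refl

  minimal-↑ˡ : ∀ i → Minimal A i → Minimal (compose c A B) (i ↑ˡ k)
  minimal-↑ˡ i min y yRi with splitAt-view m y
  ... | inj₁ (y′ , refl) = cong (_↑ˡ k) (min y′ (subst T (compose-↑ˡ-↑ˡ y′ i) yRi))
  ... | inj₂ (j , refl)  = ⊥-elim (subst T (compose-↑ʳ-↑ˡ j i) yRi)

  minimal-↑ˡ⁻ : ∀ i → Minimal (compose c A B) (i ↑ˡ k) → Minimal A i
  minimal-↑ˡ⁻ i min y yAi = ↑ˡ-injective k y i (min (y ↑ˡ k) (subst T (sym (compose-↑ˡ-↑ˡ y i)) yAi))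

  minimal-↑ʳ⁻ : ∀ j → Minimal (compose c A B) (m ↑ʳ j) → Minimal B j
  minimal-↑ʳ⁻ j min y yBj = ↑ʳ-injective m y j (min (m ↑ʳ y) (subst T (sym (compose-↑ʳ-↑ʳ y j)) yBj))

minimal-↑ʳ : ∀ {m k} (A : BoolRel m) (B : BoolRel k) j → Minimal B j → Minimal (compose false A B) (m ↑ʳ j)
minimal-↑ʳ {m} A B j min y yRj with splitAt-view m y
... | inj₁ (i , refl)  = ⊥-elim (subst T (compose-↑ˡ-↑ʳ false A B i j) yRj)
... | inj₂ (j′ , refl) = cong (m ↑ʳ_) (min j′ (subst T (compose-↑ʳ-↑ʳ false A B j′ j) yRj))

¬minimal-↑ʳ : ∀ {m k} (A : BoolRel (suc m)) (B : BoolRel k) j → ¬ Minimal (compose true A B) (suc m ↑ʳ j)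
¬minimal-↑ʳ A B j min = 0≢1+n (min fz (subst T (sym (compose-↑ˡ-↑ʳ true A B fz j)) tt))

splitAt-punchIn-↑ˡ : ∀ m k (i : Fin (suc m)) (z : Fin (m + k)) →
  splitAt (suc m) (punchIn (i ↑ˡ k) z) ≡ map₁ (punchIn i) (splitAt m z)
splitAt-punchIn-↑ˡ m       k fz     z      = refl
splitAt-punchIn-↑ˡ (suc m) k (fs i) fz     = refl
splitAt-punchIn-↑ˡ (suc m) k (fs i) (fs z) = begin
  map₁ fs (splitAt (suc m) (punchIn (i ↑ˡ k) z)) ≡⟨ cong (map₁ fs) (splitAt-punchIn-↑ˡ m k i z) ⟩
  map₁ fs (map₁ (punchIn i) (splitAt m z))       ≡⟨ map-map (splitAt m z) ⟩
  map₁ (λ t → fs (punchIn i t)) (splitAt m z)    ≡⟨ map-map (splitAt m z) ⟨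
  map₁ (punchIn (fs i)) (splitAt (suc m) (fs z)) ∎

splitAt-punchIn-↑ʳ : ∀ m k (j : Fin (suc k)) (z : Fin (suc m + k)) (e : suc m + k ≡ m + suc k) →
  splitAt (suc m) (punchIn (suc m ↑ʳ j) (cast e z)) ≡ map₂ (punchIn j) (splitAt (suc m) z)
splitAt-punchIn-↑ʳ zero    k j fz     e = refl
splitAt-punchIn-↑ʳ zero    k j (fs z) e rewrite cast-is-id (cong pred e) z = refl
splitAt-punchIn-↑ʳ (suc m) k j fz     e = refl
splitAt-punchIn-↑ʳ (suc m) k j (fs z) e =
  trans (cong (map₁ fs) (splitAt-punchIn-↑ʳ m k j z (cong pred e))) (map₁₂-map₂₁ (splitAt (suc m) z))

module _ (c : Bool) {m k} (A : BoolRel m) (B : BoolRel k) where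

  sumRel-map₁ : ∀ {m′} (h : Fin m′ → Fin m) s s′ →
    sumRel c A B (map₁ h s) (map₁ h s′) ≡ sumRel c (λ a b → A (h a) (h b)) B s s′
  sumRel-map₁ h (inj₁ x) (inj₁ y) = refl
  sumRel-map₁ h (inj₁ x) (inj₂ y) = refl
  sumRel-map₁ h (inj₂ x) (inj₁ y) = refl
  sumRel-map₁ h (inj₂ x) (inj₂ y) = refl

  sumRel-map₂ : ∀ {k′} (h : Fin k′ → Fin k) s s′ →
    sumRel c A B (map₂ h s) (map₂ h s′) ≡ sumRel c A (λ a b → B (h a) (h b)) s s′
  sumRel-map₂ h (inj₁ x) (inj₁ y) = refl
  sumRel-map₂ h (inj₁ x) (inj₂ y) = refl
  sumRel-map₂ h (inj₂ x) (inj₁ y) = refl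
  sumRel-map₂ h (inj₂ x) (inj₂ y) = refl

restrict-↑ˡ : ∀ c {m k} (A : BoolRel (suc m)) (B : BoolRel k) i a b →
  restrict (compose c A B) (i ↑ˡ k) a b ≡ compose c (restrict A i) B a b
restrict-↑ˡ c {m} {k} A B i a b =
  trans (cong₂ (sumRel c A B) (splitAt-punchIn-↑ˡ m k i a) (splitAt-punchIn-↑ˡ m k i b))
        (sumRel-map₁ c A B (punchIn i) (splitAt m a) (splitAt m b))

restrict-↑ʳ : ∀ c {m k} (A : BoolRel (suc m)) (B : BoolRel (suc k)) j (e : suc m + k ≡ m + suc k) a b →
  restrict (compose c A B) (suc m ↑ʳ j) (cast e a) (cast e b) ≡ compose c A (restrict B j) a b
restrict-↑ʳ c {m} {k} A B j e a b =
  trans (cong₂ (sumRel c A B) (splitAt-punchIn-↑ʳ m k j a e) (splitAt-punchIn-↑ʳ m k j b e))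
        (sumRel-map₂ c A B (punchIn j) (splitAt (suc m) a) (splitAt (suc m) b))

-- Counting root states of series and parallel compositions

sum-↑ : ∀ m k (f : Fin (m + k) → ℕ) → sum f ≡ sum (λ i → f (i ↑ˡ k)) + sum (λ j → f (m ↑ʳ j))
sum-↑ zero    k f = refl
sum-↑ (suc m) k f = trans (cong (f fz +_) (sum-↑ m k (λ i → f (fs i)))) (sym (+-assoc (f fz) _ _))

sum≡rootCount* : ∀ {n} (R : BoolRel (suc n)) s (f : Fin (suc n) → ℕ) →
  (∀ x → Minimal R x → f x ≡ rootCount n (restrict R x) * s) → (∀ x → ¬ Minimal R x → f x ≡ 0) →
  sum f ≡ rootCount (suc n) R * s
sum≡rootCount* R s f f-minimal f-¬minimal = begin
  sum f                             ≡⟨ sum-cong-≗ (λ x → term x (minimal? R x)) ⟩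
  sum (λ x → rootsFirstAt R x * s)  ≡⟨ *-distribʳ-sum s (rootsFirstAt R) ⟨
  sum (rootsFirstAt R) * s          ≡⟨ cong (_* s) (rootCount-peel R) ⟨
  rootCount _ R * s                 ∎
  where
  term : ∀ x → Dec (Minimal R x) → f x ≡ rootsFirstAt R x * s
  term x (yes min) = trans (f-minimal x min) (cong (_* s) (sym (rootsFirstAt-minimal R x min)))
  term x (no ¬min) = trans (f-¬minimal x ¬min) (cong (_* s) (sym (rootsFirstAt-¬minimal R x ¬min)))

rootCount-compose : ∀ c {m k} (A : BoolRel (suc m)) (B : BoolRel k) →
  rootCount (suc m + k) (compose c A B)
    ≡ sum (λ i → rootsFirstAt (compose c A B) (i ↑ˡ k)) + sum (λ j → rootsFirstAt (compose c A B) (suc m ↑ʳ j))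
rootCount-compose c {m} {k} A B = trans (rootCount-peel (compose c A B)) (sum-↑ (suc m) k (rootsFirstAt (compose c A B)))

sum-rootsFirstAt-↑ˡ : ∀ c {m k} (A : BoolRel (suc m)) (B : BoolRel k) s →
  (∀ A′ → rootCount (m + k) (compose c A′ B) ≡ rootCount m A′ * s) →
  sum (λ i → rootsFirstAt (compose c A B) (i ↑ˡ k)) ≡ rootCount (suc m) A * s
sum-rootsFirstAt-↑ˡ c {m} {k} A B s count = sum≡rootCount* A s (λ i → rootsFirstAt (compose c A B) (i ↑ˡ k))
  (λ i min → begin
    rootsFirstAt (compose c A B) (i ↑ˡ k)                 ≡⟨ rootsFirstAt-minimal (compose c A B) _ (minimal-↑ˡ c A B i min) ⟩
    rootCount (m + k) (restrict (compose c A B) (i ↑ˡ k)) ≡⟨ rootCount-cong (restrict-↑ˡ c A B i) ⟩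
    rootCount (m + k) (compose c (restrict A i) B)        ≡⟨ count (restrict A i) ⟩
    rootCount m (restrict A i) * s                        ∎)
  (λ i ¬min → rootsFirstAt-¬minimal (compose c A B) _ (λ min → ¬min (minimal-↑ˡ⁻ c A B i min)))

sum-rootsFirstAt-↑ʳ : ∀ {m k} (A : BoolRel (suc m)) (B : BoolRel (suc k)) t →
  (∀ B′ → rootCount (suc m + k) (compose false A B′) ≡ rootCount k B′ * t) →
  sum (λ j → rootsFirstAt (compose false A B) (suc m ↑ʳ j)) ≡ rootCount (suc k) B * t
sum-rootsFirstAt-↑ʳ {m} {k} A B t count = sum≡rootCount* B t (λ j → rootsFirstAt (compose false A B) (suc m ↑ʳ j))
  (λ j min → begin
    rootsFirstAt (compose false A B) (suc m ↑ʳ j)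
      ≡⟨ rootsFirstAt-minimal (compose false A B) _ (minimal-↑ʳ A B j min) ⟩
    rootCount (m + suc k) (restrict (compose false A B) (suc m ↑ʳ j))
      ≡⟨ rootCount-cast e _ ⟩
    rootCount (suc m + k) (λ a b → restrict (compose false A B) (suc m ↑ʳ j) (cast e a) (cast e b))
      ≡⟨ rootCount-cong (restrict-↑ʳ false A B j e) ⟩
    rootCount (suc m + k) (compose false A (restrict B j))
      ≡⟨ count (restrict B j) ⟩
    rootCount k (restrict B j) * t
      ∎)
  (λ j ¬min → rootsFirstAt-¬minimal (compose false A B) _ (λ min → ¬min (minimal-↑ʳ⁻ false A B j min)))
  where
  e : suc m + k ≡ m + suc k
  e = sym (+-suc m k)

rootCount-series : ∀ m k (A : BoolRel m) (B : BoolRel k) →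
  rootCount (m + k) (compose true A B) ≡ rootCount m A * rootCount k B
rootCount-series zero    k A B = sym (+-identityʳ _)
rootCount-series (suc m) k A B = begin
  rootCount (suc m + k) (compose true A B)
    ≡⟨ rootCount-compose true A B ⟩
  sum (λ i → rootsFirstAt (compose true A B) (i ↑ˡ k)) + sum (λ j → rootsFirstAt (compose true A B) (suc m ↑ʳ j))
    ≡⟨ cong₂ _+_ (sum-rootsFirstAt-↑ˡ true A B (rootCount k B) (λ A′ → rootCount-series m k A′ B))
                 (trans (sum-cong-≗ (λ j → rootsFirstAt-¬minimal (compose true A B) _ (¬minimal-↑ʳ A B j))) (sum-replicate-zero k)) ⟩
  rootCount (suc m) A * rootCount k B + 0
    ≡⟨ +-identityʳ _ ⟩
  rootCount (suc m) A * rootCount k B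
    ∎

C-diagonal : ∀ m → (m + 0) C m ≡ 1
C-diagonal m = trans (cong (_C m) (+-identityʳ m)) (nCn≡1 m)

C-pascal : ∀ m k → (m + suc k) C m + (suc m + k) C suc m ≡ (suc m + suc k) C suc m
C-pascal m k rewrite +-suc m k = nCk+nC[k+1]≡[n+1]C[k+1] (suc m + k) m

rootCount-parallel : ∀ m k (A : BoolRel m) (B : BoolRel k) →
  rootCount (m + k) (compose false A B) ≡ ((m + k) C m) * (rootCount m A * rootCount k B)
rootCount-parallel zero    k A B = begin
  rootCount k B             ≡⟨ *-identityˡ (rootCount k B) ⟨
  1 * rootCount k B         ≡⟨ *-identityˡ (1 * rootCount k B) ⟨
  1 * (1 * rootCount k B)   ∎
rootCount-parallel (suc m) zero A B = begin
  rootCount (suc m + 0) (compose false A B)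
    ≡⟨ rootCount-compose false {m} {0} A B ⟩
  sum (λ i → rootsFirstAt (compose false A B) (i ↑ˡ 0)) + 0
    ≡⟨ +-identityʳ _ ⟩
  sum (λ i → rootsFirstAt (compose false A B) (i ↑ˡ 0))
    ≡⟨ sum-rootsFirstAt-↑ˡ false {m} {0} A B (((m + 0) C m) * 1)
         (λ A′ → trans (rootCount-parallel m 0 A′ B) (x∙yz≈y∙xz ((m + 0) C m) (rootCount m A′) 1)) ⟩
  rootCount (suc m) A * (((m + 0) C m) * 1)
    ≡⟨ x∙yz≈y∙xz (rootCount (suc m) A) ((m + 0) C m) 1 ⟩
  ((m + 0) C m) * (rootCount (suc m) A * 1)
    ≡⟨ cong (_* (rootCount (suc m) A * 1)) (trans (C-diagonal m) (sym (C-diagonal (suc m)))) ⟩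
  ((suc m + 0) C suc m) * (rootCount (suc m) A * 1)
    ∎
rootCount-parallel (suc m) (suc k) A B = begin
  rootCount (suc m + suc k) (compose false A B)
    ≡⟨ rootCount-compose false {m} {suc k} A B ⟩
  sum (λ (i : Fin (suc m)) → rootsFirstAt (compose false A B) (i ↑ˡ suc k))
    + sum (λ (j : Fin (suc k)) → rootsFirstAt (compose false A B) (suc m ↑ʳ j))
    ≡⟨ cong₂ _+_ (sum-rootsFirstAt-↑ˡ false {m} {suc k} A B (X * b)
                   (λ A′ → trans (rootCount-parallel m (suc k) A′ B) (x∙yz≈y∙xz X (rootCount m A′) b)))
                 (sum-rootsFirstAt-↑ʳ {m} {k} A B (Y * a)
                   (λ B′ → trans (rootCount-parallel (suc m) k A B′) (swap Y a (rootCount k B′)))) ⟩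
  a * (X * b) + b * (Y * a)
    ≡⟨ distribute a b X Y ⟩
  (X + Y) * (a * b)
    ≡⟨ cong (_* (a * b)) (C-pascal m k) ⟩
  ((suc m + suc k) C suc m) * (a * b)
    ∎
  where
  a b X Y : ℕ
  a = rootCount (suc m) A
  b = rootCount (suc k) B
  X = (m + suc k) C m
  Y = (suc m + k) C suc m
  swap : ∀ y u v → y * (u * v) ≡ v * (y * u)
  swap = solve 3 (λ y u v → y :* (u :* v) := v :* (y :* u)) refl
  distribute : ∀ u v x y → u * (x * v) + v * (y * u) ≡ (x + y) * (u * v)
  distribute = solve 4 (λ u v x y → u :* (x :* v) :+ v :* (y :* u) := (x :+ y) :* (u :* v)) refl

C-*-factorials : ∀ m k → ((m + k) C m) * (m ! * k !) ≡ (m + k) !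
C-*-factorials m k = begin
  ((m + k) C m) * (m ! * k !)
    ≡⟨ cong₂ _*_ (nCk≡n!/k![n-k]! (m≤m+n m k)) (cong (λ t → m ! * t !) (sym (m+n∸m≡n m k))) ⟩
  (m + k) ! / (m ! * (m + k ∸ m) !) * (m ! * (m + k ∸ m) !)
    ≡⟨ m/n*n≡m (k![n∸k]!∣n! (m≤m+n m k)) ⟩
  (m + k) !
    ∎
  where instance _ = m !* (m + k ∸ m) !≢0

shuffle-product : ∀ m k a a′ b b′ → a * a′ ≡ m ! → b * b′ ≡ k ! → (a * b) * (((m + k) C m) * (a′ * b′)) ≡ (m + k) !
shuffle-product m k a a′ b b′ aa′≡m! bb′≡k! = begin
  (a * b) * (((m + k) C m) * (a′ * b′))  ≡⟨ rearrange a b ((m + k) C m) a′ b′ ⟩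
  ((m + k) C m) * ((a * a′) * (b * b′))  ≡⟨ cong₂ (λ u v → ((m + k) C m) * (u * v)) aa′≡m! bb′≡k! ⟩
  ((m + k) C m) * (m ! * k !)            ≡⟨ C-*-factorials m k ⟩
  (m + k) !                            ∎
  where
  rearrange : ∀ a b c a′ b′ → (a * b) * (c * (a′ * b′)) ≡ c * ((a * a′) * (b * b′))
  rearrange = solve 5 (λ a b c a′ b′ → (a :* b) :* (c :* (a′ :* b′)) := c :* ((a :* a′) :* (b :* b′))) refl

numRootStates-⊗ : ∀ {m k} (a : SP m) (b : SP k) → numRootStates (a ⊗ b) ≡ numRootStates a * numRootStates b
numRootStates-⊗ {m} {k} a b = trans (rootCount-cong (below-⊗ a b)) (rootCount-series m k (below a) (below b))

numRootStates-∥ : ∀ {m k} (a : SP m) (b : SP k) →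
  numRootStates (a ∥ b) ≡ ((m + k) C m) * (numRootStates a * numRootStates b)
numRootStates-∥ {m} {k} a b = trans (rootCount-cong (below-∥ a b)) (rootCount-parallel m k (below a) (below b))

theorem1 : (n : ℕ) (Ψ : SP n) → numRootStates Ψ * numRootStates (dual Ψ) ≡ n !
theorem1 _ var = refl
theorem1 _ (_⊗_ {m} {k} a b) =
  trans (cong₂ _*_ (numRootStates-⊗ a b) (numRootStates-∥ (dual a) (dual b)))
        (shuffle-product m k (N a) (N (dual a)) (N b) (N (dual b)) (theorem1 m a) (theorem1 k b))
  where
  N : ∀ {n} → SP n → ℕ
  N = numRootStates
theorem1 _ (_∥_ {m} {k} a b) = begin
  N (a ∥ b) * N (dual a ⊗ dual b)
    ≡⟨ cong₂ _*_ (numRootStates-∥ a b) (numRootStates-⊗ (dual a) (dual b)) ⟩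
  (((m + k) C m) * (N a * N b)) * (N (dual a) * N (dual b))
    ≡⟨ *-comm (((m + k) C m) * (N a * N b)) (N (dual a) * N (dual b)) ⟩
  (N (dual a) * N (dual b)) * (((m + k) C m) * (N a * N b))
    ≡⟨ shuffle-product m k (N (dual a)) (N a) (N (dual b)) (N b)
                           (trans (*-comm (N (dual a)) (N a)) (theorem1 m a))
                           (trans (*-comm (N (dual b)) (N b)) (theorem1 k b)) ⟩
  (m + k) !
    ∎
  where
  N : ∀ {n} → SP n → ℕ
  N = numRootStates
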